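{- For every odd integer $m>1$ there is an edge coloring of the complete graph on $m$ vertices that contains a colorful $m$-cycle but no colorful $4$-cycle.
   Context: An $n$-cycle is a sequence $(v_1,\dots,v_n)$ of distinct vertices, with edges $v_iv_{i+1}$, indices mod $n$. A cycle is colorful if its edges have pairwise distinct colors. -}

module Defs where

open import Data.Nat using (ℕ; suc; _<_; _≡ᵇ_)
open import Data.Fin using (Fin; zero; suc; toℕ; fromℕ<)
open import Data.Fin.Properties using (toℕ<n)
open import Data.Nat.DivMod using (_%_; m%n<n)
open import Data.Product using (Σ; _×_; _,_)
open import Relation.Binary.PropositionalEquality using (_≡_)
open import Function.Definitions using (Injective)

-- An edge coloring of the complete graph K_m (vertex set Fin m) with colors in C:
-- a color assigned to every pair of vertices, symmetric (so it is a function of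
-- the unordered edge {u,v}); values on the diagonal u = u are irrelevant (no loops).
record EdgeColoring (m : ℕ) (C : Set) : Set where
  field
    col : Fin m → Fin m → C
    sym : ∀ u v → col u v ≡ col v u
open EdgeColoring public

next : {n : ℕ} → Fin n → Fin n
next {suc n} i = fromℕ< (m%n<n (suc (toℕ i)) (suc n))

-- An n-cycle in K_m: a sequence (v_0,…,v_{n-1}) of pairwise distinct vertices;
-- the edges are v_i v_{i+1}, indices mod n.
Cycle : ℕ → ℕ → Set
Cycle m n = Σ (Fin n → Fin m) (Injective _≡_ _≡_)

edgeColor : {m n : ℕ} {C : Set} → EdgeColoring m C → Cycle m n → Fin n → C
edgeColor c (v , _) i = col c (v i) (v (next i))


Colorful : {m n : ℕ} {C : Set} → EdgeColoring m C → Cycle m n → Set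
Colorful c γ = Injective _≡_ _≡_ (edgeColor c γ)

-- Colour an edge by 0 if its endpoints have equal parity and by 1 + its smaller endpoint
-- otherwise. Along a closed walk of length four the parity changes an even number of times.
-- If it changes at most twice, two edges have colour 0; if it changes four times, the
-- smallest vertex gives both of its edges the same colour. When m is odd, the cycle
-- 0, 1, …, m − 1 has edge colours 1, …, m − 1, and its closing edge joins the even
-- vertices m − 1 and 0, so it gets the remaining colour 0.
module Submission where

open import Defs hiding (sym)
open import Data.Nat using (ℕ; _<_; _%_)
open import Data.Product using (Σ; _×_)
open import Relation.Binary.PropositionalEquality using (_≡_)
open import Relation.Nullary using (¬_)

open import Data.Nat using (zero; suc; _≤_; s≤s; _⊓_; parity)
open import Data.Nat.Properties
  using (≤-total; ≤-trans; n≤1+n; m≤n⇒m<n∨m≡n; m≤n⇒m⊓n≡m; m≥n⇒m⊓n≡n; ⊓-comm; suc-injective; 1+n≢0)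
open import Data.Nat.DivMod using (m%n<n; m<n⇒m%n≡m; n%n≡0)
open import Data.Parity.Base as ℙ using (0ℙ; 1ℙ; _⁻¹)
open import Data.Parity.Properties using (p+p≡0ℙ; p+p⁻¹≡1ℙ; ⁻¹-selfInverse; ⁻¹-involutive; suc-homo-⁻¹)
import Data.Parity.Properties as ℙ
open import Data.Fin using (Fin; zero; suc; toℕ; #_)
open import Data.Fin.Properties using (toℕ-injective; toℕ-fromℕ<; toℕ<n)
open import Data.Product using (_,_)
open import Data.Sum using (_⊎_; inj₁; inj₂)
open import Function using (id; _∘_)
open import Function.Definitions using (Injective)
open import Relation.Nullary using (contradiction)
open import Relation.Binary.PropositionalEquality using (_≢_; refl; sym; trans; cong)

collision⇒¬injective : ∀ {A B : Set} {f : A → B} x y → x ≢ y → f x ≡ f y → ¬ Injective _≡_ _≡_ f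
collision⇒¬injective x y x≢y fx≡fy f-injective = x≢y (f-injective fx≡fy)

zeros⇒¬injective : ∀ {A : Set} {f : A → ℕ} x y → x ≢ y → f x ≡ 0 → f y ≡ 0 → ¬ Injective _≡_ _≡_ f
zeros⇒¬injective x y x≢y fx≡0 fy≡0 = collision⇒¬injective x y x≢y (trans fx≡0 (sym fy≡0))

parity-%2≡1 : ∀ n → n % 2 ≡ 1 → parity n ≡ 1ℙ
parity-%2≡1 (suc zero)    _    = refl
parity-%2≡1 (suc (suc n)) n-odd = parity-%2≡1 n n-odd

parity-suc : ∀ n → parity (suc n) ≡ parity n ⁻¹
parity-suc n = sym (⁻¹-selfInverse (suc-homo-⁻¹ n))

parityColor : ℕ → ℕ → ℕ
parityColor x y with parity x ℙ.+ parity y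
... | 0ℙ = 0
... | 1ℙ = suc (x ⊓ y)

parityColor-comm : ∀ x y → parityColor x y ≡ parityColor y x
parityColor-comm x y rewrite ℙ.+-comm (parity x) (parity y) with parity y ℙ.+ parity x
... | 0ℙ = refl
... | 1ℙ = cong suc (⊓-comm x y)

parityColor-same : ∀ {x y p} → parity x ≡ p → parity y ≡ p → parityColor x y ≡ 0
parityColor-same {p = p} refl y≡p rewrite y≡p | p+p≡0ℙ p = refl

parityColor-opposite : ∀ {x y p} → parity x ≡ p → parity y ≡ p ⁻¹ → parityColor x y ≡ suc (x ⊓ y)
parityColor-opposite {p = p} refl y≡p⁻¹ rewrite y≡p⁻¹ | p+p⁻¹≡1ℙ p = refl

parityColor-suc : ∀ x → parityColor x (suc x) ≡ suc x
parityColor-suc x = trans (parityColor-opposite refl (parity-suc x)) (cong suc (m≤n⇒m⊓n≡m (n≤1+n x)))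

parityColoring : (m : ℕ) → EdgeColoring m ℕ
parityColoring m = record
  { col = λ u v → parityColor (toℕ u) (toℕ v)
  ; sym = λ u v → parityColor-comm (toℕ u) (toℕ v)
  }

local-min-⊓ : ∀ {x y z} → x ≤ y → x ≤ z → y ⊓ x ≡ x ⊓ z
local-min-⊓ x≤y x≤z = trans (m≥n⇒m⊓n≡n x≤y) (sym (m≤n⇒m⊓n≡m x≤z))

-- The edges on either side of a smallest vertex have the same minimum.
adjacentMinima-¬injective : (w : Fin 4 → ℕ) → ¬ Injective _≡_ _≡_ (λ i → w i ⊓ w (next i))
adjacentMinima-¬injective w
  with ≤-total (w (# 0)) (w (# 1)) | ≤-total (w (# 1)) (w (# 2))
     | ≤-total (w (# 2)) (w (# 3)) | ≤-total (w (# 3)) (w (# 0))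
... | inj₁ a≤b | _ | _ | inj₂ a≤d = collision⇒¬injective (# 3) (# 0) (λ ()) (local-min-⊓ a≤d a≤b)
... | inj₂ b≤a | inj₁ b≤c | _ | _ = collision⇒¬injective (# 0) (# 1) (λ ()) (local-min-⊓ b≤a b≤c)
... | _ | inj₂ c≤b | inj₁ c≤d | _ = collision⇒¬injective (# 1) (# 2) (λ ()) (local-min-⊓ c≤b c≤d)
... | _ | _ | inj₂ d≤c | inj₁ d≤a = collision⇒¬injective (# 2) (# 3) (λ ()) (local-min-⊓ d≤c d≤a)
... | inj₁ a≤b | inj₁ b≤c | inj₁ c≤d | inj₁ _ =
  collision⇒¬injective (# 3) (# 0) (λ ()) (local-min-⊓ (≤-trans a≤b (≤-trans b≤c c≤d)) a≤b)
... | inj₂ b≤a | inj₂ c≤b | inj₂ d≤c | inj₂ a≤d =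
  collision⇒¬injective (# 3) (# 0) (λ ()) (local-min-⊓ a≤d (≤-trans a≤d (≤-trans d≤c c≤b)))

squareColor : (Fin 4 → ℕ) → Fin 4 → ℕ
squareColor w i = parityColor (w i) (w (next i))

alternatingSquare-¬colorful : ∀ (w : Fin 4 → ℕ) {p} →
  parity (w (# 0)) ≡ p → parity (w (# 1)) ≡ p ⁻¹ → parity (w (# 2)) ≡ p → parity (w (# 3)) ≡ p ⁻¹ →
  ¬ Injective _≡_ _≡_ (squareColor w)
alternatingSquare-¬colorful w {p} p₀ p₁ p₂ p₃ colorful =
  adjacentMinima-¬injective w λ {i} {j} eq →
    colorful (trans (opposite i) (trans (cong suc eq) (sym (opposite j))))
  where
  opposite : ∀ i → squareColor w i ≡ suc (w i ⊓ w (next i))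
  opposite zero                   = parityColor-opposite p₀ p₁
  opposite (suc zero)             = parityColor-opposite p₁ (trans p₂ (sym (⁻¹-involutive p)))
  opposite (suc (suc zero))       = parityColor-opposite p₂ p₃
  opposite (suc (suc (suc zero))) = parityColor-opposite p₃ (trans p₀ (sym (⁻¹-involutive p)))

no-colorful-square : (w : Fin 4 → ℕ) → ¬ Injective _≡_ _≡_ (squareColor w)
no-colorful-square w
  with parity (w (# 0)) in p₀ | parity (w (# 1)) in p₁
     | parity (w (# 2)) in p₂ | parity (w (# 3)) in p₃
... | 0ℙ | 0ℙ | 0ℙ | _  = zeros⇒¬injective (# 0) (# 1) (λ ()) (parityColor-same p₀ p₁) (parityColor-same p₁ p₂)
... | 1ℙ | 1ℙ | 1ℙ | _  = zeros⇒¬injective (# 0) (# 1) (λ ()) (parityColor-same p₀ p₁) (parityColor-same p₁ p₂)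
... | 0ℙ | 0ℙ | 1ℙ | 1ℙ = zeros⇒¬injective (# 0) (# 2) (λ ()) (parityColor-same p₀ p₁) (parityColor-same p₂ p₃)
... | 1ℙ | 1ℙ | 0ℙ | 0ℙ = zeros⇒¬injective (# 0) (# 2) (λ ()) (parityColor-same p₀ p₁) (parityColor-same p₂ p₃)
... | 0ℙ | 0ℙ | 1ℙ | 0ℙ = zeros⇒¬injective (# 0) (# 3) (λ ()) (parityColor-same p₀ p₁) (parityColor-same p₃ p₀)
... | 1ℙ | 1ℙ | 0ℙ | 1ℙ = zeros⇒¬injective (# 0) (# 3) (λ ()) (parityColor-same p₀ p₁) (parityColor-same p₃ p₀)
... | _  | 0ℙ | 0ℙ | 0ℙ = zeros⇒¬injective (# 1) (# 2) (λ ()) (parityColor-same p₁ p₂) (parityColor-same p₂ p₃)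
... | _  | 1ℙ | 1ℙ | 1ℙ = zeros⇒¬injective (# 1) (# 2) (λ ()) (parityColor-same p₁ p₂) (parityColor-same p₂ p₃)
... | 0ℙ | 1ℙ | 1ℙ | 0ℙ = zeros⇒¬injective (# 1) (# 3) (λ ()) (parityColor-same p₁ p₂) (parityColor-same p₃ p₀)
... | 1ℙ | 0ℙ | 0ℙ | 1ℙ = zeros⇒¬injective (# 1) (# 3) (λ ()) (parityColor-same p₁ p₂) (parityColor-same p₃ p₀)
... | 0ℙ | 1ℙ | 0ℙ | 0ℙ = zeros⇒¬injective (# 2) (# 3) (λ ()) (parityColor-same p₂ p₃) (parityColor-same p₃ p₀)
... | 1ℙ | 0ℙ | 1ℙ | 1ℙ = zeros⇒¬injective (# 2) (# 3) (λ ()) (parityColor-same p₂ p₃) (parityColor-same p₃ p₀)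
... | 0ℙ | 1ℙ | 0ℙ | 1ℙ = alternatingSquare-¬colorful w p₀ p₁ p₂ p₃
... | 1ℙ | 0ℙ | 1ℙ | 0ℙ = alternatingSquare-¬colorful w p₀ p₁ p₂ p₃

toℕ-next : ∀ {n} (i : Fin (suc n)) → toℕ (next i) ≡ suc (toℕ i) % suc n
toℕ-next {n} i = toℕ-fromℕ< (m%n<n (suc (toℕ i)) (suc n))

suc-%-cases : ∀ {n x} → x < suc n → suc x % suc n ≡ suc x ⊎ (x ≡ n × suc x % suc n ≡ 0)
suc-%-cases {n} (s≤s x≤n) with m≤n⇒m<n∨m≡n x≤n
... | inj₁ x<n  = inj₁ (m<n⇒m%n≡m (s≤s x<n))
... | inj₂ refl = inj₂ (refl , n%n≡0 (suc n))

suc-%-injective : ∀ {n x y} → x < suc n → y < suc n → suc x % suc n ≡ suc y % suc n → x ≡ y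
suc-%-injective x<1+n y<1+n eq with suc-%-cases x<1+n | suc-%-cases y<1+n
... | inj₁ ex         | inj₁ ey         = suc-injective (trans (sym ex) (trans eq ey))
... | inj₁ ex         | inj₂ (_ , ey)   = contradiction (trans (sym ex) (trans eq ey)) 1+n≢0
... | inj₂ (_ , ex)   | inj₁ ey         = contradiction (trans (sym ey) (trans (sym eq) ex)) 1+n≢0
... | inj₂ (x≡n , _)  | inj₂ (y≡n , _)  = trans x≡n (sym y≡n)

next-injective : ∀ {n} → Injective _≡_ _≡_ (next {n})
next-injective {suc n} {i} {j} eq = toℕ-injective (suc-%-injective (toℕ<n i) (toℕ<n j)
  (trans (sym (toℕ-next i)) (trans (cong toℕ eq) (toℕ-next j))))

parityColor-suc-% : ∀ {n x} → parity n ≡ 0ℙ → x < suc n → parityColor x (suc x % suc n) ≡ suc x % suc n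
parityColor-suc-% {x = x} n-even x<1+n with suc-%-cases x<1+n
... | inj₁ ex         rewrite ex = parityColor-suc x
... | inj₂ (refl , ez) rewrite ez = parityColor-same n-even refl

hamiltonianCycle-colorful : ∀ {n} → parity n ≡ 0ℙ →
  Colorful (parityColoring (suc n)) (id , id)
hamiltonianCycle-colorful n-even {i} {j} eq = next-injective (toℕ-injective
  (trans (sym (color≡next i)) (trans eq (color≡next j))))
  where
  color≡next : ∀ i → parityColor (toℕ i) (toℕ (next i)) ≡ toℕ (next i)
  color≡next i rewrite toℕ-next i = parityColor-suc-% n-even (toℕ<n i)

mainTheorem5 : (m : ℕ) → m % 2 ≡ 1 → 1 < m →
    Σ (EdgeColoring m ℕ) λ c →
      Σ (Cycle m m) (Colorful c)
      × ((γ : Cycle m 4) → ¬ Colorful c γ)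
mainTheorem5 (suc n) m-odd _ =
  parityColoring (suc n) ,
  ((id , id) , hamiltonianCycle-colorful n-even) ,
  λ (v , _) → no-colorful-square (toℕ ∘ v)
  where
  n-even : parity n ≡ 0ℙ
  n-even = trans (sym (suc-homo-⁻¹ n)) (cong _⁻¹ (parity-%2≡1 (suc n) m-odd))
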